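{- For every $n\geq 1$, $$\sum_{T\in \mathcal P_{n,0}}x^{{\rm young}_T(1)}t^{{\rm eld}(T)}=\prod_{k=0}^{n-2}(x+k+kt).$$ In particular, the number of increasing trees on $[n]$ is $(n-1)!$ and the number of increasing plane trees on $[n]$ is $(2n-3)!!$.
   Context: A plane tree on a finite totally ordered set $V$ is a rooted tree with vertex set $V$ in which the children of each vertex are linearly ordered (from left to right). A vertex $j$ is a descendant of $i$ if the path from the root to $j$ passes through $i$ (each vertex is a descendant of itself); $\beta_T(i)$ denotes the smallest descendant of $i$. A child $j$ of a vertex $v$ is called elder if $v$ has a child $k$ to the right of $j$ with $\beta_T(k)<\beta_T(j)$; otherwise younger. ${\rm young}_T(v)$ is the number of younger children of $v$ and ${\rm eld}(T)$ the total number of elder vertices of $T$. An edge $(i,j)$ with $j$ a child of $i$ is proper if $j$ is an elder child of $i$ or $i<\beta_T(j)$, and improper otherwise. $\mathcal P_{n,0}$ is the set of plane trees on $[n]=\{1,\dots,n\}$ (arbitrary root) with no improper edges. A (plane) tree on $[n]$ is increasing if every path from the root to another vertex is an increasing sequence. Convention: $(-1)!!=1$. -}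

module Defs where

open import Data.Nat using (ℕ; zero; suc; _+_; _*_; _∸_; _^_; _<_; _⊓_; _<ᵇ_)

open import Data.Bool using (Bool; true; false; if_then_else_)
open import Data.List using (List; []; _∷_; length; map; upTo; applyUpTo)
open import Data.Bool.ListAction using (any)
open import Data.Nat.ListAction using (sum; product)
open import Data.List.Membership.Propositional using (_∈_)
open import Data.List.Relation.Unary.Unique.Propositional using (Unique)
open import Data.List.Relation.Binary.Permutation.Propositional using (_↭_)
open import Data.Product using (_×_)
open import Data.Sum using (_⊎_)
open import Data.Unit using (⊤)
open import Relation.Binary.PropositionalEquality using (_≡_)
open import Function.Bundles using (_⇔_)

-- Two plane trees are equal iff they have the
-- same root, and the same ordered lists of children at every vertex, i.e.
-- syntactic equality of this datatype is equality of plane trees.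

data PTree : Set where
  node : ℕ → List PTree → PTree

label : PTree → ℕ
label (node v _) = v

mutual
  labels : PTree → List ℕ
  labels (node v cs) = v ∷ labelsF cs

  labelsF : List PTree → List ℕ
  labelsF []       = []
  labelsF (c ∷ cs) = labels c Data.List.++ labelsF cs

OnSet : ℕ → PTree → Set
OnSet n T = labels T ↭ applyUpTo suc n

mutual
  β : PTree → ℕ
  β (node v cs) = βF v cs

  βF : ℕ → List PTree → ℕ
  βF acc []       = acc
  βF acc (c ∷ cs) = βF (acc ⊓ β c) cs

isElder : PTree → List PTree → Bool
isElder c rest = any (λ k → β k <ᵇ β c) rest

elderCount : List PTree → ℕ
elderCount []       = 0
elderCount (c ∷ cs) = (if isElder c cs then 1 else 0) + elderCount cs

youngCount : List PTree → ℕ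
youngCount cs = length cs ∸ elderCount cs

mutual
  eld : PTree → ℕ
  eld (node _ cs) = elderCount cs + eldF cs

  eldF : List PTree → ℕ
  eldF []       = 0
  eldF (c ∷ cs) = eld c + eldF cs

-- young_T(v): number of younger children of the vertex labelled v
-- (summed over all vertices labelled v; on a tree on [n] there is exactly one)
mutual
  young : ℕ → PTree → ℕ
  young v (node w cs) = (if w Data.Nat.≡ᵇ v then youngCount cs else 0) + youngF v cs

  youngF : ℕ → List PTree → ℕ
  youngF v []       = 0
  youngF v (c ∷ cs) = young v c + youngF v cs

ProperEdge : ℕ → PTree → List PTree → Set
ProperEdge i c rest = (isElder c rest ≡ true) ⊎ (i < β c)

AllProperChildren : ℕ → List PTree → Set
AllProperChildren i []       = ⊤
AllProperChildren i (c ∷ cs) = ProperEdge i c cs × AllProperChildren i cs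

mutual
  NoImproper : PTree → Set
  NoImproper (node i cs) = AllProperChildren i cs × NoImproperF cs

  NoImproperF : List PTree → Set
  NoImproperF []       = ⊤
  NoImproperF (c ∷ cs) = NoImproper c × NoImproperF cs

InP0 : ℕ → PTree → Set
InP0 n T = OnSet n T × NoImproper T

mutual
  Increasing : PTree → Set
  Increasing (node i cs) = IncreasingF i cs

  IncreasingF : ℕ → List PTree → Set
  IncreasingF i []       = ⊤
  IncreasingF i (c ∷ cs) = (i < label c) × Increasing c × IncreasingF i cs

-- children listed in increasing order of labels, at every vertex
-- (canonical representative of a non-plane tree)
mutual
  SortedChildren : PTree → Set
  SortedChildren (node _ cs) = SortedF cs

  SortedF : List PTree → Set
  SortedF []       = ⊤
  SortedF (c ∷ cs) = Below (label c) cs × SortedChildren c × SortedF cs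

  Below : ℕ → List PTree → Set
  Below a []       = ⊤
  Below a (d ∷ ds) = a < label d

IncPlane : ℕ → PTree → Set
IncPlane n T = OnSet n T × Increasing T

-- increasing (non-plane) trees on [n], each represented by the unique plane
-- tree with children ordered increasingly by label
IncTree : ℕ → PTree → Set
IncTree n T = IncPlane n T × SortedChildren T

Enumerates : (PTree → Set) → List PTree → Set
Enumerates P L = Unique L × (∀ T → (T ∈ L) ⇔ P T)

prodUpTo : ℕ → (ℕ → ℕ) → ℕ
prodUpTo m f = product (map f (upTo m))

-- (2m-1)!! = 1·3·5···(2m-1), with (-1)!! = 1 (m = 0)
oddDoubleFact : ℕ → ℕ
oddDoubleFact zero    = 1
oddDoubleFact (suc m) = (2 * m + 1) * oddDoubleFact m

weight : ℕ → ℕ → PTree → ℕ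
weight x t T = x ^ young 1 T * t ^ eld T

module Submission where

-- The maximal vertex n of a tree in 𝒫_{n,0} is a leaf, since no edge from n to its (younger) last
-- child can be proper.  Removing or adding a maximal leaf changes neither β nor the elder status of
-- the other vertices, so the trees of 𝒫_{n,0} are obtained exactly once each by inserting the leaf n
-- into one of the 2k+1 slots of a tree of 𝒫_{n-1,0} (n = k+2): in front of one of its k non-root
-- vertices, where the new leaf is elder (weight t), or last among the children of one of its k+1
-- vertices, where it is younger (weight x under the vertex 1, and 1 elsewhere).  The slots thus
-- weigh x + k + kt in total, and the product follows by induction.  Increasing plane trees grow by
-- the same insertions, and increasing trees with sorted children by insertions into the k+1 last
-- slots only, whence (2n-3)!! and (n-1)!.

open import Defs
open import Data.Bool using (Bool; true; false; T; if_then_else_; _∨_)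
open import Data.Bool.Properties using (T-≡)
open import Data.Bool.ListAction using (any)
open import Data.Empty using (⊥; ⊥-elim)
open import Data.List using (List; []; _∷_; [_]; _++_; length; map; concatMap; applyUpTo; upTo)
open import Data.List.Properties
  using (length-map; length-++; length-applyUpTo; map-++; map-∘; map-cong-local; applyUpTo-∷ʳ; ∷-injective; ∷-injectiveˡ)
open import Data.List.Membership.Propositional using (_∈_; _∉_; find; lose)
open import Data.List.Membership.Propositional.Properties
  using (∈-++⁻; ∈-++⁺ˡ; ∈-++⁺ʳ; ∈-map⁺; ∈-map⁻; ∈-concatMap⁺; ∈-concatMap⁻; ∈-applyUpTo⁺; ∈-applyUpTo⁻)
open import Data.List.Membership.Propositional.Properties.WithK using (unique∧set⇒bag)
open import Data.List.Relation.Binary.BagAndSetEquality using (∼bag⇒↭)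
open import Data.List.Relation.Binary.Permutation.Propositional using (_↭_; ↭-refl; ↭-sym; ↭-trans; prep; swap)
open import Data.List.Relation.Binary.Permutation.Propositional.Properties
  using (↭-length; ↭-singleton-inv; ++⁺ˡ; ++⁺ʳ; shift; drop-∷; ∷↭∷ʳ; ∈-resp-↭; map⁺)
open import Data.List.Relation.Unary.All as All using (All; []; _∷_)
open import Data.List.Relation.Unary.All.Properties using (++⁻ˡ; ++⁻ʳ) renaming (++⁺ to All-++⁺; map⁺ to All-map⁺)
open import Data.List.Relation.Unary.Any using (here; there)
open import Data.List.Relation.Unary.Unique.Propositional using (Unique)
import Data.List.Relation.Unary.Unique.Propositional.Properties as Unique
open import Data.List.Relation.Unary.AllPairs using ([]; _∷_)
open import Data.List.Relation.Binary.Disjoint.Propositional using (Disjoint)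
open import Data.Nat using (ℕ; zero; suc; _+_; _*_; _∸_; _^_; _≤_; _<_; _!; _⊓_; _<ᵇ_; _≡ᵇ_; z≤n; s≤s; s≤s⁻¹)
open import Data.Nat.ListAction using (sum; product)
open import Data.Nat.ListAction.Properties using (sum-++; sum-↭; product-++)
open import Data.Nat.Properties
open import Data.Nat.Tactic.RingSolver using (solve-∀)
open import Data.Product using (_×_; _,_; proj₁; proj₂; ∃-syntax)
open import Data.Product.Function.NonDependent.Propositional using (_×-⇔_)
open import Data.Sum using (_⊎_; inj₁; inj₂; map₁)
open import Data.Unit using (tt)
open import Function using (_∘_; const)
open import Function.Bundles using (_⇔_; mk⇔; Equivalence)
open import Function.Properties.Equivalence using () renaming (refl to ⇔-refl)
open import Relation.Binary.PropositionalEquality using (_≡_; refl; sym; trans; cong; cong₂; subst; module ≡-Reasoning)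

open Equivalence using (to; from)

-- Sums, products and permutations of lists

All-<⇒∉ : ∀ {m xs} → All (_< m) xs → m ∉ xs
All-<⇒∉ bound m∈xs = <-irrefl refl (All.lookup bound m∈xs)

Unique-concatMap⁺ : ∀ {A B : Set} {f : A → List B} {xs} → Unique xs → (∀ {x} → x ∈ xs → Unique (f x)) →
                    (∀ {x y z} → x ∈ xs → y ∈ xs → z ∈ f x → z ∈ f y → x ≡ y) → Unique (concatMap f xs)
Unique-concatMap⁺ {xs = []} _ _ _ = []
Unique-concatMap⁺ {f = f} {xs = x ∷ xs} (x∉xs ∷ unique) uniqueᶠ injective =
  Unique.++⁺ (uniqueᶠ (here refl))
             (Unique-concatMap⁺ unique (uniqueᶠ ∘ there) (λ x∈ y∈ → injective (there x∈) (there y∈)))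
             disjoint
  where
  disjoint : Disjoint (f x) (concatMap f xs)
  disjoint (z∈fx , z∈rest) with find (∈-concatMap⁻ f {xs = xs} z∈rest)
  ... | y , y∈xs , z∈fy = All.lookup x∉xs y∈xs (injective (here refl) (there y∈xs) z∈fx z∈fy)

sum-map-++ : ∀ {A : Set} (f : A → ℕ) xs ys → sum (map f (xs ++ ys)) ≡ sum (map f xs) + sum (map f ys)
sum-map-++ f xs ys = trans (cong sum (map-++ f xs ys)) (sum-++ (map f xs) (map f ys))

sum-map-∘ : ∀ {A B : Set} (f : B → ℕ) (g : A → B) xs → sum (map f (map g xs)) ≡ sum (map (f ∘ g) xs)
sum-map-∘ f g xs = cong sum (sym (map-∘ xs))

sum-map-cong : ∀ {A : Set} {f g : A → ℕ} {xs} → All (λ y → f y ≡ g y) xs → sum (map f xs) ≡ sum (map g xs)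
sum-map-cong = cong sum ∘ map-cong-local

sum-map-*ˡ : ∀ {A : Set} k (f : A → ℕ) xs → sum (map (λ y → k * f y) xs) ≡ k * sum (map f xs)
sum-map-*ˡ k f []       = sym (*-zeroʳ k)
sum-map-*ˡ k f (y ∷ xs) = trans (cong (k * f y +_) (sum-map-*ˡ k f xs)) (sym (*-distribˡ-+ k (f y) _))

sum-map-*ʳ : ∀ {A : Set} k (f : A → ℕ) xs → sum (map (λ y → f y * k) xs) ≡ sum (map f xs) * k
sum-map-*ʳ k f []       = refl
sum-map-*ʳ k f (y ∷ xs) = trans (cong (f y * k +_) (sum-map-*ʳ k f xs)) (sym (*-distribʳ-+ k (f y) _))

sum-map-const-1 : ∀ {A : Set} (xs : List A) → sum (map (const 1) xs) ≡ length xs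
sum-map-const-1 []       = refl
sum-map-const-1 (_ ∷ xs) = cong suc (sum-map-const-1 xs)

sum-concatMap : ∀ {A B : Set} (h : B → ℕ) (f : A → List B) xs →
                sum (map h (concatMap f xs)) ≡ sum (map (sum ∘ map h ∘ f) xs)
sum-concatMap h f []       = refl
sum-concatMap h f (x ∷ xs) =
  trans (sum-map-++ h (f x) (concatMap f xs)) (cong (sum (map h (f x)) +_) (sum-concatMap h f xs))

prodUpTo-suc : ∀ (f : ℕ → ℕ) k → prodUpTo (suc k) f ≡ prodUpTo k f * f k
prodUpTo-suc f k = begin
  product (map f (upTo (suc k)))             ≡⟨ cong (product ∘ map f) (applyUpTo-∷ʳ (λ i → i) k) ⟨
  product (map f (upTo k ++ [ k ]))          ≡⟨ cong product (map-++ f (upTo k) [ k ]) ⟩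
  product (map f (upTo k) ++ [ f k ])        ≡⟨ product-++ (map f (upTo k)) [ f k ] ⟩
  product (map f (upTo k)) * (f k * 1)       ≡⟨ cong (product (map f (upTo k)) *_) (*-identityʳ (f k)) ⟩
  product (map f (upTo k)) * f k             ∎
  where open ≡-Reasoning

prodUpTo-recurrence : ∀ (f g : ℕ → ℕ) → g 0 ≡ 1 → (∀ k → g (suc k) ≡ f k * g k) → ∀ k → prodUpTo k f ≡ g k
prodUpTo-recurrence f g g0 _    zero    = sym g0
prodUpTo-recurrence f g g0 step (suc k) = begin
  prodUpTo (suc k) f   ≡⟨ prodUpTo-suc f k ⟩
  prodUpTo k f * f k   ≡⟨ cong (_* f k) (prodUpTo-recurrence f g g0 step k) ⟩
  g k * f k            ≡⟨ *-comm (g k) (f k) ⟩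
  f k * g k            ≡⟨ step k ⟨
  g (suc k)            ∎
  where open ≡-Reasoning

applyUpTo-suc-↭ : ∀ n → applyUpTo suc (suc n) ↭ suc n ∷ applyUpTo suc n
applyUpTo-suc-↭ n = subst (_↭ suc n ∷ applyUpTo suc n) (applyUpTo-∷ʳ suc n) (↭-sym (∷↭∷ʳ (suc n) (applyUpTo suc n)))

enumerations-↭ : ∀ {P Q : PTree → Set} {xs ys} → (∀ {T} → P T ⇔ Q T) → Enumerates P xs → Enumerates Q ys → xs ↭ ys
enumerations-↭ P⇔Q (unique-xs , ∈xs⇔P) (unique-ys , ∈ys⇔Q) =
  ∼bag⇒↭ (unique∧set⇒bag unique-xs unique-ys
            (λ {T} → mk⇔ (from (∈ys⇔Q T) ∘ to P⇔Q ∘ to (∈xs⇔P T)) (from (∈xs⇔P T) ∘ from P⇔Q ∘ to (∈ys⇔Q T))))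

-- Inserting a new maximal leaf

leaf : ℕ → PTree
leaf m = node m []

AllBelow : ℕ → List PTree → Set
AllBelow m cs = All (_< m) (labelsF cs)

All-labelsF-∷⁻ : ∀ {P : ℕ → Set} c cs → All P (labelsF (c ∷ cs)) → All P (labels c) × All P (labelsF cs)
All-labelsF-∷⁻ c _ a = ++⁻ˡ (labels c) a , ++⁻ʳ (labels c) a

All-labelsF-node⁻ : ∀ {P : ℕ → Set} w ds cs → All P (labelsF (node w ds ∷ cs)) →
                    P w × All P (labelsF ds) × All P (labelsF cs)
All-labelsF-node⁻ w ds cs a =
  All.head (++⁻ˡ (w ∷ labelsF ds) a) , All.tail (++⁻ˡ (w ∷ labelsF ds) a) , ++⁻ʳ (w ∷ labelsF ds) a

All-label : ∀ {P : ℕ → Set} c → All P (labels c) → P (label c)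
All-label (node _ _) = All.head

βF≤ : ∀ acc cs → βF acc cs ≤ acc
βF≤ acc []       = ≤-refl
βF≤ acc (c ∷ cs) = ≤-trans (βF≤ (acc ⊓ β c) cs) (m⊓n≤m acc (β c))

β≤label : ∀ c → β c ≤ label c
β≤label (node v cs) = βF≤ v cs

β<-bound : ∀ {m} c → All (_< m) (labels c) → β c < m
β<-bound c bound = ≤-<-trans (β≤label c) (All-label c bound)

≥⇒<ᵇ≡false : ∀ {m n} → n ≤ m → (m <ᵇ n) ≡ false
≥⇒<ᵇ≡false z≤n       = refl
≥⇒<ᵇ≡false (s≤s n≤m) = ≥⇒<ᵇ≡false n≤m

labelsF≡[]⇒[] : ∀ cs → labelsF cs ≡ [] → cs ≡ []
labelsF≡[]⇒[] []      _  = refl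
labelsF≡[]⇒[] (node _ _ ∷ _) ()

-- Insert anywhere m cs cs′: cs′ is the forest cs with a new leaf m added to one of its sibling lists
-- (the top-level list of cs included); unless anywhere holds, only at the end of a sibling list.
data Insert (anywhere : Bool) (m : ℕ) : List PTree → List PTree → Set where
  end   : Insert anywhere m [] [ leaf m ]
  front : ∀ {c cs} → T anywhere → Insert anywhere m (c ∷ cs) (leaf m ∷ c ∷ cs)
  down  : ∀ {w ds ds′ cs} → Insert anywhere m ds ds′ → Insert anywhere m (node w ds ∷ cs) (node w ds′ ∷ cs)
  next  : ∀ {c cs cs′} → Insert anywhere m cs cs′ → Insert anywhere m (c ∷ cs) (c ∷ cs′)

module _ {b : Bool} {m : ℕ} where

  labelsF-insert : ∀ {cs cs′} → Insert b m cs cs′ → labelsF cs′ ↭ m ∷ labelsF cs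
  labelsF-insert end = ↭-refl
  labelsF-insert (front _) = ↭-refl
  labelsF-insert (down {w} {cs = cs} p) =
    ↭-trans (prep w (++⁺ʳ (labelsF cs) (labelsF-insert p))) (swap w m ↭-refl)
  labelsF-insert (next {c} {cs} p) =
    ↭-trans (++⁺ˡ (labels c) (labelsF-insert p)) (shift m (labels c) (labelsF cs))

  ∈-insert : ∀ {cs cs′} → Insert b m cs cs′ → m ∈ labelsF cs′
  ∈-insert p = ∈-resp-↭ (↭-sym (labelsF-insert p)) (here refl)

  βF-insert : ∀ {ds ds′ acc} → Insert b m ds ds′ → acc < m → AllBelow m ds → βF acc ds′ ≡ βF acc ds
  βF-insert end acc<m _ = m≤n⇒m⊓n≡m (<⇒≤ acc<m)
  βF-insert (front {c} {cs} _) acc<m _ = cong (λ a → βF a (c ∷ cs)) (m≤n⇒m⊓n≡m (<⇒≤ acc<m))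
  βF-insert {acc = acc} (down {w} {ds} {cs = cs} p) _ bound =
    let w<m , ds<m , _ = All-labelsF-node⁻ w ds cs bound
    in cong (λ z → βF (acc ⊓ z) cs) (βF-insert p w<m ds<m)
  βF-insert {acc = acc} (next {c} {cs} p) acc<m bound =
    βF-insert p (≤-<-trans (m⊓n≤m acc (β c)) acc<m) (proj₂ (All-labelsF-∷⁻ c cs bound))

  isElder-insert : ∀ {cs cs′} → Insert b m cs cs′ → AllBelow m cs →
                   ∀ {c} → β c ≤ m → isElder c cs′ ≡ isElder c cs
  isElder-insert end _ βc≤m = cong (_∨ false) (≥⇒<ᵇ≡false βc≤m)
  isElder-insert (front {d} {ds} _) _ {c} βc≤m = cong (_∨ isElder c (d ∷ ds)) (≥⇒<ᵇ≡false βc≤m)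
  isElder-insert (down {w} {ds} {cs = cs} p) bound {c} _ =
    let w<m , ds<m , _ = All-labelsF-node⁻ w ds cs bound
    in cong (λ z → (z <ᵇ β c) ∨ isElder c cs) (βF-insert p w<m ds<m)
  isElder-insert (next {d} {ds} p) bound {c} βc≤m =
    cong ((β d <ᵇ β c) ∨_) (isElder-insert p (proj₂ (All-labelsF-∷⁻ d ds bound)) {c} βc≤m)

properEdge-β : ∀ {i} c c′ rest → β c ≡ β c′ → ProperEdge i c rest → ProperEdge i c′ rest
properEdge-β {i} _ _ rest = subst (λ z → (any (λ k → β k <ᵇ z) rest ≡ true) ⊎ (i < z))

properEdge-rest : ∀ {i} c rest rest′ → isElder c rest ≡ isElder c rest′ → ProperEdge i c rest → ProperEdge i c rest′
properEdge-rest _ _ _ same = map₁ (trans (sym same))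

module _ {b : Bool} {m : ℕ} where

  noImproper-insert : ∀ {i cs cs′} → Insert b m cs cs′ → AllBelow m cs → i < m →
                      NoImproper (node i cs′) ⇔ NoImproper (node i cs)
  noImproper-insert end _ i<m = mk⇔ (const (tt , tt)) (const ((inj₂ i<m , tt) , (tt , tt) , tt))
  noImproper-insert (front _) _ i<m =
    mk⇔ (λ ((_ , apc) , _ , nif) → apc , nif) (λ (apc , nif) → (inj₂ i<m , apc) , (tt , tt) , nif)
  noImproper-insert (down {w} {ds} {ds′} {cs} p) bound _ =
    let w<m , ds<m , _ = All-labelsF-node⁻ w ds cs bound
        sameβ = βF-insert p w<m ds<m
    in (mk⇔ (properEdge-β (node w ds′) (node w ds) cs sameβ)
            (properEdge-β (node w ds) (node w ds′) cs (sym sameβ)) ×-⇔ ⇔-refl)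
       ×-⇔ (noImproper-insert p ds<m w<m ×-⇔ ⇔-refl)
  noImproper-insert (next {c} {cs} {cs′} p) bound i<m =
    mk⇔ (λ ((pe , apc) , nc , nif) → let apc′ , nif′ = to rest (apc , nif)
                                      in (properEdge-rest c cs′ cs sameElder pe , apc′) , nc , nif′)
        (λ ((pe , apc) , nc , nif) → let apc′ , nif′ = from rest (apc , nif)
                                      in (properEdge-rest c cs cs′ (sym sameElder) pe , apc′) , nc , nif′)
    where
    c<m = proj₁ (All-labelsF-∷⁻ c cs bound)
    cs<m = proj₂ (All-labelsF-∷⁻ c cs bound)
    sameElder = isElder-insert p cs<m {c} (<⇒≤ (β<-bound c c<m))
    rest = noImproper-insert p cs<m i<m

  increasing-insert : ∀ {i cs cs′} → Insert b m cs cs′ → AllBelow m cs → i < m →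
                      Increasing (node i cs′) ⇔ Increasing (node i cs)
  increasing-insert end _ i<m = mk⇔ (const tt) (const (i<m , tt , tt))
  increasing-insert (front _) _ i<m = mk⇔ (proj₂ ∘ proj₂) (λ inc → i<m , tt , inc)
  increasing-insert (down {w} {ds} {cs = cs} p) bound _ =
    let w<m , ds<m , _ = All-labelsF-node⁻ w ds cs bound
    in ⇔-refl ×-⇔ increasing-insert p ds<m w<m ×-⇔ ⇔-refl
  increasing-insert (next {c} {cs} p) bound i<m =
    ⇔-refl ×-⇔ ⇔-refl ×-⇔ increasing-insert p (proj₂ (All-labelsF-∷⁻ c cs bound)) i<m

module _ {m : ℕ} where

  below-insert : ∀ {a cs cs′} → Insert false m cs cs′ → a < m → Below a cs′ ⇔ Below a cs
  below-insert end a<m = mk⇔ (const tt) (const a<m)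
  below-insert (front ())
  below-insert (down _) _ = ⇔-refl
  below-insert (next _) _ = ⇔-refl

  sorted-insert : ∀ {v cs cs′} → Insert false m cs cs′ → AllBelow m cs →
                  SortedChildren (node v cs′) ⇔ SortedChildren (node v cs)
  sorted-insert end _ = mk⇔ (const tt) (const (tt , tt , tt))
  sorted-insert (front ())
  sorted-insert (down {w} {ds} {cs = cs} p) bound =
    let _ , ds<m , _ = All-labelsF-node⁻ w ds cs bound
    in ⇔-refl ×-⇔ sorted-insert {w} p ds<m ×-⇔ ⇔-refl
  sorted-insert {v} (next {c} {cs} p) bound =
    let c<m , cs<m = All-labelsF-∷⁻ c cs bound
    in below-insert p (All-label c c<m) ×-⇔ ⇔-refl ×-⇔ sorted-insert {v} p cs<m

-- A class of plane trees grown one maximal leaf at a time: in a member the maximal label is a leaf in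
-- an allowed slot, and inserting a maximal leaf into an allowed slot preserves and reflects membership.
record GrowthClass : Set₁ where
  field
    anywhere        : Bool
    Holds           : PTree → Set
    holds-leaf      : Holds (leaf 1)
    holds-insert    : ∀ {m v cs cs′} → Insert anywhere m cs cs′ → AllBelow m cs → v < m →
                      Holds (node v cs′) ⇔ Holds (node v cs)
    holds-children  : ∀ {v c cs} → Holds (node v (c ∷ cs)) → Holds c × Holds (node v cs)
    holds-childless : ∀ {v cs} → All (_≤ v) (labelsF cs) → Holds (node v cs) → cs ≡ []
    holds-notLast   : ∀ {v m ds c cs} → All (_≤ m) (labelsF (c ∷ cs)) →
                      Holds (node v (node m ds ∷ c ∷ cs)) → T anywhere

-- The last child is younger, so its edge is proper only if its β exceeds the parent.
properChildren-childless : ∀ {v} cs → All (_≤ v) (labelsF cs) → AllProperChildren v cs → cs ≡ []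
properChildren-childless [] _ _ = refl
properChildren-childless (c ∷ []) _ (inj₁ () , _)
properChildren-childless (c ∷ []) bound (inj₂ v<βc , _) =
  ⊥-elim (<⇒≱ v<βc (≤-trans (β≤label c) (All-label c (proj₁ (All-labelsF-∷⁻ c [] bound)))))
properChildren-childless (c ∷ d ∷ ds) bound (_ , proper)
  with properChildren-childless (d ∷ ds) (proj₂ (All-labelsF-∷⁻ c (d ∷ ds) bound)) proper
... | ()

increasing-childless : ∀ {v cs} → All (_≤ v) (labelsF cs) → Increasing (node v cs) → cs ≡ []
increasing-childless {cs = []} _ _ = refl
increasing-childless {cs = c ∷ cs} bound (v<c , _) =
  ⊥-elim (<⇒≱ v<c (All-label c (proj₁ (All-labelsF-∷⁻ c cs bound))))

noImproperClass : GrowthClass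
noImproperClass = record
  { anywhere        = true
  ; Holds           = NoImproper
  ; holds-leaf      = tt , tt
  ; holds-insert    = noImproper-insert
  ; holds-children  = λ ((_ , proper) , nc , ncs) → nc , proper , ncs
  ; holds-childless = λ {_} {cs} bound (proper , _) → properChildren-childless cs bound proper
  ; holds-notLast   = λ _ _ → tt
  }

increasingClass : GrowthClass
increasingClass = record
  { anywhere        = true
  ; Holds           = Increasing
  ; holds-leaf      = tt
  ; holds-insert    = increasing-insert
  ; holds-children  = λ (_ , ic , ics) → ic , ics
  ; holds-childless = increasing-childless
  ; holds-notLast   = λ _ _ → tt
  }

sortedIncreasingClass : GrowthClass
sortedIncreasingClass = record
  { anywhere        = false
  ; Holds           = λ T → Increasing T × SortedChildren T
  ; holds-leaf      = tt , tt
  ; holds-insert    = λ {_} {v} p bound v<m → increasing-insert p bound v<m ×-⇔ sorted-insert {v = v} p bound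
  ; holds-children  = λ ((_ , ic , ics) , (_ , sc , scs)) → (ic , sc) , (ics , scs)
  ; holds-childless = λ bound (inc , _) → increasing-childless bound inc
  ; holds-notLast   = λ {_} {_} {_} {c} {cs} bound (_ , m<c , _) →
                        ⊥-elim (<⇒≱ m<c (All-label c (proj₁ (All-labelsF-∷⁻ c cs bound))))
  }

-- Enumeration by insertion

frontInsertions : Bool → ℕ → List PTree → List (List PTree)
frontInsertions true  m cs = [ leaf m ∷ cs ]
frontInsertions false _ _  = []

insertions : Bool → ℕ → List PTree → List (List PTree)
insertions b m []               = [ [ leaf m ] ]
insertions b m (node w ds ∷ cs) =
  frontInsertions b m (node w ds ∷ cs)
  ++ map (λ ds′ → node w ds′ ∷ cs) (insertions b m ds)
  ++ map (node w ds ∷_) (insertions b m cs)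

frontInsertions-sound : ∀ b {m c cs} → All (Insert b m (c ∷ cs)) (frontInsertions b m (c ∷ cs))
frontInsertions-sound true  = front tt ∷ []
frontInsertions-sound false = []

insertions-sound : ∀ {b m} cs → All (Insert b m cs) (insertions b m cs)
insertions-sound [] = end ∷ []
insertions-sound {b} (node w ds ∷ cs) =
  All-++⁺ (frontInsertions-sound b)
          (All-++⁺ (All-map⁺ (All.map down (insertions-sound ds))) (All-map⁺ (All.map next (insertions-sound cs))))

∈-frontInsertions : ∀ {b m cs} → T b → (leaf m ∷ cs) ∈ frontInsertions b m cs
∈-frontInsertions {true} _ = here refl

insertions-complete : ∀ {b m cs cs′} → Insert b m cs cs′ → cs′ ∈ insertions b m cs
insertions-complete end = here refl
insertions-complete (front {node _ _} t) = ∈-++⁺ˡ (∈-frontInsertions t)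
insertions-complete {b} {m} (down {w} {ds} {cs = cs} p) =
  ∈-++⁺ʳ (frontInsertions b m (node w ds ∷ cs)) (∈-++⁺ˡ (∈-map⁺ (λ ds′ → node w ds′ ∷ cs) (insertions-complete p)))
insertions-complete {b} {m} (next {node w ds} {cs} p) =
  ∈-++⁺ʳ (frontInsertions b m (node w ds ∷ cs))
         (∈-++⁺ʳ (map (λ ds′ → node w ds′ ∷ cs) (insertions b m ds)) (∈-map⁺ (node w ds ∷_) (insertions-complete p)))

insertions-unique : ∀ {b m} cs → AllBelow m cs → Unique (insertions b m cs)
insertions-unique [] _ = [] ∷ []
insertions-unique {b} {m} (node w ds ∷ cs) bound =
  Unique.++⁺ (frontsUnique b)
             (Unique.++⁺ (Unique.map⁺ (λ { refl → refl }) (insertions-unique ds ds<m))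
                         (Unique.map⁺ (λ { refl → refl }) (insertions-unique cs cs<m))
                         downs∩nexts)
             (fronts∩rest b)
  where
  bounds = All-labelsF-node⁻ w ds cs bound
  w<m = proj₁ bounds
  ds<m = proj₁ (proj₂ bounds)
  cs<m = proj₂ (proj₂ bounds)
  downs = map (λ ds′ → node w ds′ ∷ cs) (insertions b m ds)
  nexts = map (node w ds ∷_) (insertions b m cs)

  frontsUnique : ∀ b → Unique (frontInsertions b m (node w ds ∷ cs))
  frontsUnique true  = [] ∷ []
  frontsUnique false = []

  downs∩nexts : Disjoint downs nexts
  downs∩nexts (d , n) with ∈-map⁻ _ d | ∈-map⁻ _ n
  ... | ds′ , ds′∈ , refl | _ , _ , refl =
    All-<⇒∉ ds<m (∈-insert (All.lookup (insertions-sound ds) ds′∈))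

  leaf≢w : ∀ {ds′ cs′ cs″} → leaf m ∷ cs″ ≡ node w ds′ ∷ cs′ → ⊥
  leaf≢w e = <-irrefl (sym (cong label (∷-injectiveˡ e))) w<m

  fronts∩rest : ∀ b′ → Disjoint (frontInsertions b′ m (node w ds ∷ cs)) (downs ++ nexts)
  fronts∩rest false (() , _)
  fronts∩rest true (here refl , r) with ∈-++⁻ downs r
  ... | inj₁ d = leaf≢w (proj₂ (proj₂ (∈-map⁻ _ d)))
  ... | inj₂ n = leaf≢w (proj₂ (proj₂ (∈-map⁻ _ n)))

insert-injective : ∀ {b m cs₁ cs₂ cs} → Insert b m cs₁ cs → Insert b m cs₂ cs →
                   AllBelow m cs₁ → AllBelow m cs₂ → cs₁ ≡ cs₂
insert-injective end      end      _ _ = refl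
insert-injective end      (down ()) _ _
insert-injective end      (next ()) _ _
insert-injective (front _) (front _) _ _ = refl
insert-injective (front _) (down ()) _ _
insert-injective (front _) (next _) _ (m<m ∷ _) = ⊥-elim (<-irrefl refl m<m)
insert-injective (down ())  end _ _
insert-injective (down ())  (front _) _ _
insert-injective (down {w} {ds₁} {cs = cs} p) (down {ds = ds₂} q) bound₁ bound₂ =
  let _ , ds₁<m , _ = All-labelsF-node⁻ w ds₁ cs bound₁
      _ , ds₂<m , _ = All-labelsF-node⁻ w ds₂ cs bound₂
  in cong (λ ds₀ → node w ds₀ ∷ cs) (insert-injective p q ds₁<m ds₂<m)
insert-injective (down {w} {ds′ = ds′} p) (next {cs = cs₂} _) _ bound₂ =
  let _ , ds′<m , _ = All-labelsF-node⁻ w ds′ cs₂ bound₂ in ⊥-elim (All-<⇒∉ ds′<m (∈-insert p))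
insert-injective (next ())  end _ _
insert-injective (next _) (front _) (m<m ∷ _) _ = ⊥-elim (<-irrefl refl m<m)
insert-injective (next {cs = cs₁} _) (down {w} {ds′ = ds′} q) bound₁ _ =
  let _ , ds′<m , _ = All-labelsF-node⁻ w ds′ cs₁ bound₁ in ⊥-elim (All-<⇒∉ ds′<m (∈-insert q))
insert-injective (next {c} {cs₁} p) (next {cs = cs₂} q) bound₁ bound₂ =
  cong (c ∷_) (insert-injective p q (proj₂ (All-labelsF-∷⁻ c cs₁ bound₁)) (proj₂ (All-labelsF-∷⁻ c cs₂ bound₂)))

growths : Bool → ℕ → PTree → List PTree
growths b m (node v cs) = map (node v) (insertions b m cs)

-- The trees on [k+1] grown from the vertex 1 by inserting the leaves 2, …, k+1.
grown : Bool → ℕ → List PTree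
grown b zero    = [ leaf 1 ]
grown b (suc k) = concatMap (growths b (suc (suc k))) (grown b k)

data GrownFrom (b : Bool) (k : ℕ) : PTree → Set where
  grownFrom : ∀ {v cs₀ cs} → node v cs₀ ∈ grown b k → Insert b (suc (suc k)) cs₀ cs → GrownFrom b k (node v cs)

∈-growths⁻ : ∀ {b m v T} cs₀ → T ∈ growths b m (node v cs₀) → ∃[ cs ] Insert b m cs₀ cs × T ≡ node v cs
∈-growths⁻ cs₀ T∈ =
  let cs , cs∈ , T≡ = ∈-map⁻ _ T∈ in cs , All.lookup (insertions-sound cs₀) cs∈ , T≡

∈-grown-suc⁻ : ∀ {b} k {T} → T ∈ grown b (suc k) → GrownFrom b k T
∈-grown-suc⁻ {b} k T∈ with find (∈-concatMap⁻ (growths b (suc (suc k))) {xs = grown b k} T∈)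
... | node v cs₀ , T₀∈ , T∈growths with ∈-growths⁻ cs₀ T∈growths
...   | _ , p , refl = grownFrom T₀∈ p

onSet-insert : ∀ {b n v cs₀ cs} → Insert b (suc n) cs₀ cs → OnSet (suc n) (node v cs) ⇔ OnSet n (node v cs₀)
onSet-insert {n = n} {v} p = mk⇔
  (λ onSet → drop-∷ (↭-trans (↭-sym addMax) (↭-trans onSet (applyUpTo-suc-↭ n))))
  (λ onSet₀ → ↭-trans addMax (↭-trans (prep (suc n) onSet₀) (↭-sym (applyUpTo-suc-↭ n))))
  where
  addMax = ↭-trans (prep v (labelsF-insert p)) (swap v (suc n) ↭-refl)

onSet-< : ∀ {n T} → OnSet n T → All (_< suc n) (labels T)
onSet-< {n} onSet = All.tabulate (bounded ∘ ∈-applyUpTo⁻ suc ∘ ∈-resp-↭ onSet)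
  where
  bounded : ∀ {x} → ∃[ i ] i < n × x ≡ suc i → x < suc n
  bounded (_ , i<n , refl) = s≤s i<n

onSet-≤ : ∀ {n T} → OnSet n T → All (_≤ n) (labels T)
onSet-≤ = All.map s≤s⁻¹ ∘ onSet-<

onSet-max : ∀ {n T} → OnSet (suc n) T → suc n ∈ labels T
onSet-max onSet = ∈-resp-↭ (↭-sym onSet) (∈-applyUpTo⁺ suc ≤-refl)

onSet-size : ∀ {k v cs} → OnSet (suc k) (node v cs) → length (labelsF cs) ≡ k
onSet-size {k} onSet = suc-injective (trans (↭-length onSet) (length-applyUpTo suc (suc k)))

grown-onSet : ∀ {b} k {T} → T ∈ grown b k → OnSet (suc k) T
grown-onSet zero (here refl) = ↭-refl
grown-onSet (suc k) T∈ with ∈-grown-suc⁻ k T∈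
... | grownFrom T₀∈ p = from (onSet-insert p) (grown-onSet k T₀∈)

grown-unique : ∀ {b} k → Unique (grown b k)
grown-unique zero = [] ∷ []
grown-unique {b} (suc k) = Unique-concatMap⁺ (grown-unique k) growthsUnique growthsDisjoint
  where
  bound : ∀ {v cs₀} → node v cs₀ ∈ grown b k → AllBelow (suc (suc k)) cs₀
  bound {v} {cs₀} T∈ = All.tail (onSet-< {T = node v cs₀} (grown-onSet k T∈))

  growthsUnique : ∀ {T} → T ∈ grown b k → Unique (growths b (suc (suc k)) T)
  growthsUnique {node _ cs₀} T∈ = Unique.map⁺ (λ { refl → refl }) (insertions-unique cs₀ (bound T∈))

  growthsDisjoint : ∀ {T₁ T₂ T} → T₁ ∈ grown b k → T₂ ∈ grown b k →
                    T ∈ growths b (suc (suc k)) T₁ → T ∈ growths b (suc (suc k)) T₂ → T₁ ≡ T₂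
  growthsDisjoint {node v cs₁} {node _ cs₂} T₁∈ T₂∈ T∈₁ T∈₂ with ∈-growths⁻ cs₁ T∈₁ | ∈-growths⁻ cs₂ T∈₂
  ... | _ , p , refl | _ , q , refl = cong (node v) (insert-injective p q (bound T₁∈) (bound T₂∈))

module _ (C : GrowthClass) where
  open GrowthClass C

  grown-holds : ∀ k {T} → T ∈ grown anywhere k → Holds T
  grown-holds zero (here refl) = holds-leaf
  grown-holds (suc k) T∈ with ∈-grown-suc⁻ k T∈
  ... | grownFrom {v} {cs₀} T₀∈ p =
    let bound = onSet-< {T = node v cs₀} (grown-onSet k T₀∈)
    in from (holds-insert p (All.tail bound) (All.head bound)) (grown-holds k T₀∈)

  uninsert-head : ∀ {m v ds cs} → All (_≤ m) (labelsF (node m ds ∷ cs)) → Holds (node v (node m ds ∷ cs)) →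
                  ∃[ cs₀ ] Insert anywhere m cs₀ (node m ds ∷ cs)
  uninsert-head {m} {ds = ds} {cs} bound h
    with holds-childless (proj₁ (proj₂ (All-labelsF-node⁻ m ds cs bound))) (proj₁ (holds-children h))
  uninsert-head {cs = []}     _     _ | refl = [] , end
  uninsert-head {cs = c ∷ cs} bound h | refl = c ∷ cs , front (holds-notLast (All.tail bound) h)

  uninsert : ∀ {m v cs} → m ∈ labelsF cs → All (_≤ m) (labelsF cs) → Holds (node v cs) →
             ∃[ cs₀ ] Insert anywhere m cs₀ cs
  uninsert {cs = node w ds ∷ cs} m∈ bound h
    with ∈-++⁻ (w ∷ labelsF ds) m∈ | All-labelsF-node⁻ w ds cs bound | holds-children h
  ... | inj₁ (here refl)  | _            | _ = uninsert-head bound h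
  ... | inj₁ (there m∈ds) | _ , ds≤m , _ | hw , _ = let ds₀ , p = uninsert m∈ds ds≤m hw in node w ds₀ ∷ cs , down p
  ... | inj₂ m∈cs         | _ , _ , cs≤m | _ , hv = let cs₀ , p = uninsert m∈cs cs≤m hv in node w ds ∷ cs₀ , next p

  grown-complete : ∀ k {T} → OnSet (suc k) T → Holds T → T ∈ grown anywhere k
  grown-complete zero {node v cs} onSet _ with ∷-injective (↭-singleton-inv onSet)
  ... | refl , noLabels with labelsF≡[]⇒[] cs noLabels
  ...   | refl = here refl
  grown-complete (suc k) {node v cs} onSet h with onSet-max {T = node v cs} onSet
  ... | here refl with holds-childless (All.tail (onSet-≤ {T = node v cs} onSet)) h
  ...   | refl with ↭-length onSet
  ...     | ()
  grown-complete (suc k) {node v cs} onSet h | there m∈cs =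
    let cs₀ , p = uninsert {cs = cs} m∈cs (All.tail (onSet-≤ {T = node v cs} onSet)) h
        onSet₀ = to (onSet-insert p) onSet
        bound = onSet-< {T = node v cs₀} onSet₀
        T₀∈ = grown-complete k onSet₀ (to (holds-insert p (All.tail bound) (All.head bound)) h)
    in ∈-concatMap⁺ (growths anywhere (suc (suc k))) (lose T₀∈ (∈-map⁺ (node v) (insertions-complete p)))

  grown-enumerates : ∀ k → Enumerates (λ T → OnSet (suc k) T × Holds T) (grown anywhere k)
  grown-enumerates k =
    grown-unique k ,
    λ T → mk⇔ (λ T∈ → grown-onSet k T∈ , grown-holds k T∈) (λ (onSet , h) → grown-complete k onSet h)

-- Counting and weighing the slots

sum-grown : ∀ {b} (h : PTree → ℕ) (f : ℕ → ℕ) → h (leaf 1) ≡ 1 →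
            (∀ k {T} → T ∈ grown b k → sum (map h (growths b (suc (suc k)) T)) ≡ h T * f k) →
            ∀ k → sum (map h (grown b k)) ≡ prodUpTo k f
sum-grown h f h-leaf _ zero = trans (+-identityʳ (h (leaf 1))) h-leaf
sum-grown {b} h f h-leaf h-growths (suc k) = begin
  sum (map h (concatMap (growths b (suc (suc k))) (grown b k)))
    ≡⟨ sum-concatMap h (growths b (suc (suc k))) (grown b k) ⟩
  sum (map (sum ∘ map h ∘ growths b (suc (suc k))) (grown b k))
    ≡⟨ sum-map-cong (All.tabulate (h-growths k)) ⟩
  sum (map (λ T → h T * f k) (grown b k))
    ≡⟨ sum-map-*ʳ (f k) h (grown b k) ⟩
  sum (map h (grown b k)) * f k
    ≡⟨ cong (_* f k) (sum-grown h f h-leaf h-growths k) ⟩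
  prodUpTo k f * f k
    ≡⟨ prodUpTo-suc f k ⟨
  prodUpTo (suc k) f ∎
  where open ≡-Reasoning

width : Bool → ℕ
width true  = 2
width false = 1

suc-length-frontInsertions : ∀ b {m cs} → suc (length (frontInsertions b m cs)) ≡ width b
suc-length-frontInsertions true  = refl
suc-length-frontInsertions false = refl

length-insertions : ∀ b m cs → length (insertions b m cs) ≡ suc (width b * length (labelsF cs))
length-insertions b m [] = cong suc (sym (*-zeroʳ (width b)))
length-insertions b m (node w ds ∷ cs) = begin
  length (fronts ++ downs ++ nexts)
    ≡⟨ length-++ fronts ⟩
  F + length (downs ++ nexts)
    ≡⟨ cong (F +_) (length-++ downs) ⟩
  F + (length downs + length nexts)
    ≡⟨ cong₂ (λ d n → F + (d + n))
             (trans (length-map _ (insertions b m ds)) (length-insertions b m ds))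
             (trans (length-map _ (insertions b m cs)) (length-insertions b m cs)) ⟩
  F + (suc (width b * Nds) + suc (width b * Ncs))
    ≡⟨ cong (λ W → F + (suc (W * Nds) + suc (W * Ncs))) (suc-length-frontInsertions b) ⟨
  F + (suc (suc F * Nds) + suc (suc F * Ncs))
    ≡⟨ slotCount F Nds Ncs ⟩
  suc (suc F * suc (Nds + Ncs))
    ≡⟨ cong₂ (λ W n → suc (W * suc n)) (suc-length-frontInsertions b) (sym (length-++ (labelsF ds))) ⟩
  suc (width b * length (labelsF (node w ds ∷ cs))) ∎
  where
  open ≡-Reasoning
  fronts = frontInsertions b m (node w ds ∷ cs)
  downs = map (λ ds′ → node w ds′ ∷ cs) (insertions b m ds)
  nexts = map (node w ds ∷_) (insertions b m cs)
  F = length fronts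
  Nds = length (labelsF ds)
  Ncs = length (labelsF cs)
  slotCount : ∀ f a c → f + (suc (suc f * a) + suc (suc f * c)) ≡ suc (suc f * suc (a + c))
  slotCount = solve-∀

length-grown : ∀ b k → length (grown b k) ≡ prodUpTo k (λ j → suc (width b * j))
length-grown b k = begin
  length (grown b k)                   ≡⟨ sum-map-const-1 (grown b k) ⟨
  sum (map (const 1) (grown b k))      ≡⟨ sum-grown (const 1) _ refl countGrowths k ⟩
  prodUpTo k (λ j → suc (width b * j)) ∎
  where
  open ≡-Reasoning
  countGrowths : ∀ k {T} → T ∈ grown b k →
                 sum (map (const 1) (growths b (suc (suc k)) T)) ≡ 1 * suc (width b * k)
  countGrowths k {node v cs} T∈ = begin
    sum (map (const 1) (map (node v) (insertions b (suc (suc k)) cs)))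
      ≡⟨ sum-map-const-1 (map (node v) (insertions b (suc (suc k)) cs)) ⟩
    length (map (node v) (insertions b (suc (suc k)) cs))
      ≡⟨ length-map (node v) (insertions b (suc (suc k)) cs) ⟩
    length (insertions b (suc (suc k)) cs)
      ≡⟨ length-insertions b _ cs ⟩
    suc (width b * length (labelsF cs))
      ≡⟨ cong (λ n → suc (width b * n)) (onSet-size {v = v} {cs} (grown-onSet k T∈)) ⟩
    suc (width b * k)
      ≡⟨ *-identityˡ _ ⟨
    1 * suc (width b * k) ∎

elderCount≤length : ∀ cs → elderCount cs ≤ length cs
elderCount≤length []       = z≤n
elderCount≤length (c ∷ cs) = step (isElder c cs) (elderCount≤length cs)
  where
  step : ∀ e {a l} → a ≤ l → (if e then 1 else 0) + a ≤ suc l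
  step true  = s≤s
  step false = m≤n⇒m≤1+n

youngCount-∷ : ∀ c cs → youngCount (c ∷ cs) ≡ (if isElder c cs then 0 else 1) + youngCount cs
youngCount-∷ c cs = step (isElder c cs) (elderCount≤length cs)
  where
  step : ∀ e {a l} → a ≤ l → suc l ∸ ((if e then 1 else 0) + a) ≡ (if e then 0 else 1) + (l ∸ a)
  step true  _   = refl
  step false a≤l = +-∸-assoc 1 a≤l

module _ (x t : ℕ) where

  monomial : ℕ → ℕ → ℕ
  monomial a b = x ^ a * t ^ b

  monomial-+ : ∀ a a′ b b′ → monomial (a + a′) (b + b′) ≡ monomial a b * monomial a′ b′
  monomial-+ a a′ b b′ = trans (cong₂ _*_ (^-distribˡ-+-* x a a′) (^-distribˡ-+-* t b b′))
                               (interchange (x ^ a) (x ^ a′) (t ^ b) (t ^ b′))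
    where
    interchange : ∀ p q r s → (p * q) * (r * s) ≡ (p * r) * (q * s)
    interchange = solve-∀

  rootFactor : ℕ → ℕ
  rootFactor v = if v ≡ᵇ 1 then x else 1

  childFactor : ℕ → PTree → List PTree → ℕ
  childFactor v c rest = if isElder c rest then t else rootFactor v

  weight-leaf : ∀ m → weight x t (leaf m) ≡ 1
  weight-leaf 0             = refl
  weight-leaf 1             = refl
  weight-leaf (suc (suc _)) = refl

  weight-∷ : ∀ v c cs → weight x t (node v (c ∷ cs)) ≡ childFactor v c cs * (weight x t c * weight x t (node v cs))
  weight-∷ v c cs = begin
    monomial (youngOf (c ∷ cs) + (young 1 c + youngF 1 cs)) ((E + elderCount cs) + (eld c + eldF cs))
      ≡⟨ cong (λ a → monomial (a + (young 1 c + youngF 1 cs)) ((E + elderCount cs) + (eld c + eldF cs)))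
              (youngOf-∷ (v ≡ᵇ 1)) ⟩
    monomial ((Y + youngOf cs) + (young 1 c + youngF 1 cs)) ((E + elderCount cs) + (eld c + eldF cs))
      ≡⟨ cong₂ monomial (regroup Y (youngOf cs) (young 1 c) (youngF 1 cs))
                        (regroup E (elderCount cs) (eld c) (eldF cs)) ⟩
    monomial (Y + (young 1 c + (youngOf cs + youngF 1 cs))) (E + (eld c + (elderCount cs + eldF cs)))
      ≡⟨ monomial-+ Y _ E _ ⟩
    monomial Y E * monomial (young 1 c + (youngOf cs + youngF 1 cs)) (eld c + (elderCount cs + eldF cs))
      ≡⟨ cong₂ _*_ (monomial-factor (isElder c cs) (v ≡ᵇ 1)) (monomial-+ (young 1 c) _ (eld c) _) ⟩
    childFactor v c cs * (weight x t c * weight x t (node v cs)) ∎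
    where
    open ≡-Reasoning
    youngOf : List PTree → ℕ
    youngOf cs′ = if v ≡ᵇ 1 then youngCount cs′ else 0
    Y = if v ≡ᵇ 1 then (if isElder c cs then 0 else 1) else 0
    E = if isElder c cs then 1 else 0
    youngOf-∷ : ∀ o → (if o then youngCount (c ∷ cs) else 0)
                      ≡ (if o then (if isElder c cs then 0 else 1) else 0) + (if o then youngCount cs else 0)
    youngOf-∷ true  = youngCount-∷ c cs
    youngOf-∷ false = refl
    regroup : ∀ a b c d → (a + b) + (c + d) ≡ a + (c + (b + d))
    regroup = solve-∀
    monomial-factor : ∀ e o → monomial (if o then (if e then 0 else 1) else 0) (if e then 1 else 0)
                              ≡ (if e then t else (if o then x else 1))
    monomial-factor true  true  = trans (*-identityˡ (t * 1)) (*-identityʳ t)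
    monomial-factor true  false = trans (*-identityˡ (t * 1)) (*-identityʳ t)
    monomial-factor false true  = trans (*-identityʳ (x * 1)) (*-identityʳ x)
    monomial-factor false false = refl

  -- The total weight of the slots for a new maximal leaf in the subtree at v: a slot in front of
  -- an existing vertex makes the leaf elder (t), the last slot under u makes it younger (x if u = 1).
  slotWeight : ℕ → List PTree → ℕ
  slotWeight v []               = rootFactor v
  slotWeight v (node w ds ∷ cs) = t + slotWeight w ds + slotWeight v cs

  sum-weights-insertions : ∀ {m} v cs → AllBelow m cs →
    sum (map (weight x t ∘ node v) (insertions true m cs)) ≡ weight x t (node v cs) * slotWeight v cs
  sum-weights-insertions {m} v [] _ = begin
    weight x t (node v [ leaf m ]) + 0                ≡⟨ +-identityʳ _ ⟩
    weight x t (node v [ leaf m ])                    ≡⟨ weight-∷ v (leaf m) [] ⟩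
    rootFactor v * (weight x t (leaf m) * weight x t (leaf v))
      ≡⟨ cong₂ (λ a b → rootFactor v * (a * b)) (weight-leaf m) (weight-leaf v) ⟩
    rootFactor v * 1                                  ≡⟨ *-comm (rootFactor v) 1 ⟩
    1 * rootFactor v                                  ≡⟨ cong (_* rootFactor v) (weight-leaf v) ⟨
    weight x t (leaf v) * rootFactor v                ∎
    where open ≡-Reasoning
  sum-weights-insertions {m} v (node w ds ∷ cs) bound = begin
    weight x t (node v (leaf m ∷ c ∷ cs)) + sum (map g (downs ++ nexts))
      ≡⟨ cong₂ _+_ frontWeight (trans (sum-map-++ g downs nexts) (cong₂ _+_ downsWeight nextsWeight)) ⟩
    t * W + (K * Wcs * (Wc * slotWeight w ds) + K * Wc * (Wcs * slotWeight v cs))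
      ≡⟨ cong (λ z → t * z + (K * Wcs * (Wc * slotWeight w ds) + K * Wc * (Wcs * slotWeight v cs)))
              (weight-∷ v c cs) ⟩
    t * (K * (Wc * Wcs)) + (K * Wcs * (Wc * slotWeight w ds) + K * Wc * (Wcs * slotWeight v cs))
      ≡⟨ collect t K Wc Wcs (slotWeight w ds) (slotWeight v cs) ⟩
    K * (Wc * Wcs) * (t + slotWeight w ds + slotWeight v cs)
      ≡⟨ cong (_* (t + slotWeight w ds + slotWeight v cs)) (weight-∷ v c cs) ⟨
    W * slotWeight v (c ∷ cs) ∎
    where
    open ≡-Reasoning
    c = node w ds
    g = weight x t ∘ node v
    downs = map (λ ds′ → node w ds′ ∷ cs) (insertions true m ds)
    nexts = map (c ∷_) (insertions true m cs)
    W = weight x t (node v (c ∷ cs))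
    K = childFactor v c cs
    Wc = weight x t c
    Wcs = weight x t (node v cs)
    bounds = All-labelsF-node⁻ w ds cs bound
    w<m = proj₁ bounds
    ds<m = proj₁ (proj₂ bounds)
    cs<m = proj₂ (proj₂ bounds)
    βc<m = β<-bound c (proj₁ (All-labelsF-∷⁻ c cs bound))

    collect : ∀ t k a b p q → t * (k * (a * b)) + (k * b * (a * p) + k * a * (b * q)) ≡ k * (a * b) * (t + p + q)
    collect = solve-∀

    swap-right : ∀ a b c → a * (b * c) ≡ a * c * b
    swap-right = solve-∀

    frontWeight : weight x t (node v (leaf m ∷ c ∷ cs)) ≡ t * W
    frontWeight = begin
      weight x t (node v (leaf m ∷ c ∷ cs))
        ≡⟨ weight-∷ v (leaf m) (c ∷ cs) ⟩
      childFactor v (leaf m) (c ∷ cs) * (weight x t (leaf m) * W)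
        ≡⟨ cong₂ (λ e l → (if e ∨ isElder (leaf m) cs then t else rootFactor v) * (l * W))
                 (to T-≡ (<⇒<ᵇ βc<m)) (weight-leaf m) ⟩
      t * (1 * W)
        ≡⟨ cong (t *_) (*-identityˡ W) ⟩
      t * W ∎

    downWeight : ∀ {ds′} → Insert true m ds ds′ → g (node w ds′ ∷ cs) ≡ (K * Wcs) * weight x t (node w ds′)
    downWeight {ds′} p = begin
      g (node w ds′ ∷ cs)
        ≡⟨ weight-∷ v (node w ds′) cs ⟩
      childFactor v (node w ds′) cs * (weight x t (node w ds′) * Wcs)
        ≡⟨ cong (λ z → (if any (λ k → β k <ᵇ z) cs then t else rootFactor v) * (weight x t (node w ds′) * Wcs))
                (βF-insert p w<m ds<m) ⟩
      K * (weight x t (node w ds′) * Wcs)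
        ≡⟨ swap-right K (weight x t (node w ds′)) Wcs ⟩
      (K * Wcs) * weight x t (node w ds′) ∎

    downsWeight : sum (map g downs) ≡ K * Wcs * (Wc * slotWeight w ds)
    downsWeight = begin
      sum (map g downs)
        ≡⟨ sum-map-∘ g _ (insertions true m ds) ⟩
      sum (map (λ ds′ → g (node w ds′ ∷ cs)) (insertions true m ds))
        ≡⟨ sum-map-cong (All.map downWeight (insertions-sound ds)) ⟩
      sum (map (λ ds′ → (K * Wcs) * weight x t (node w ds′)) (insertions true m ds))
        ≡⟨ sum-map-*ˡ (K * Wcs) (weight x t ∘ node w) (insertions true m ds) ⟩
      K * Wcs * sum (map (weight x t ∘ node w) (insertions true m ds))
        ≡⟨ cong (K * Wcs *_) (sum-weights-insertions w ds ds<m) ⟩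
      K * Wcs * (Wc * slotWeight w ds) ∎

    nextWeight : ∀ {cs′} → Insert true m cs cs′ → g (c ∷ cs′) ≡ (K * Wc) * weight x t (node v cs′)
    nextWeight {cs′} p = begin
      g (c ∷ cs′)
        ≡⟨ weight-∷ v c cs′ ⟩
      childFactor v c cs′ * (Wc * weight x t (node v cs′))
        ≡⟨ cong (λ e → (if e then t else rootFactor v) * (Wc * weight x t (node v cs′)))
                (isElder-insert p cs<m {c} (<⇒≤ βc<m)) ⟩
      K * (Wc * weight x t (node v cs′))
        ≡⟨ *-assoc K Wc _ ⟨
      (K * Wc) * weight x t (node v cs′) ∎

    nextsWeight : sum (map g nexts) ≡ K * Wc * (Wcs * slotWeight v cs)
    nextsWeight = begin
      sum (map g nexts)
        ≡⟨ sum-map-∘ g _ (insertions true m cs) ⟩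
      sum (map (λ cs′ → g (c ∷ cs′)) (insertions true m cs))
        ≡⟨ sum-map-cong (All.map nextWeight (insertions-sound cs)) ⟩
      sum (map (λ cs′ → (K * Wc) * weight x t (node v cs′)) (insertions true m cs))
        ≡⟨ sum-map-*ˡ (K * Wc) (weight x t ∘ node v) (insertions true m cs) ⟩
      K * Wc * sum (map (weight x t ∘ node v) (insertions true m cs))
        ≡⟨ cong (K * Wc *_) (sum-weights-insertions v cs cs<m) ⟩
      K * Wc * (Wcs * slotWeight v cs) ∎

  slotWeight-labels : ∀ v cs → slotWeight v cs ≡ sum (map rootFactor (labels (node v cs))) + length (labelsF cs) * t
  slotWeight-labels v []               = sym (trans (+-identityʳ (rootFactor v + 0)) (+-identityʳ (rootFactor v)))
  slotWeight-labels v (node w ds ∷ cs) = begin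
    t + slotWeight w ds + slotWeight v cs
      ≡⟨ cong₂ (λ a b → t + a + b) (slotWeight-labels w ds) (slotWeight-labels v cs) ⟩
    t + (rootFactor w + Rds + Nds * t) + (rootFactor v + Rcs + Ncs * t)
      ≡⟨ regroup t (rootFactor w) (rootFactor v) Rds Rcs Nds Ncs ⟩
    rootFactor v + (rootFactor w + (Rds + Rcs)) + suc (Nds + Ncs) * t
      ≡⟨ cong₂ (λ r n → rootFactor v + (rootFactor w + r) + suc n * t)
               (sum-map-++ rootFactor (labelsF ds) (labelsF cs)) (length-++ (labelsF ds)) ⟨
    sum (map rootFactor (labels (node v (node w ds ∷ cs)))) + length (labelsF (node w ds ∷ cs)) * t ∎
    where
    open ≡-Reasoning
    Rds = sum (map rootFactor (labelsF ds))
    Rcs = sum (map rootFactor (labelsF cs))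
    Nds = length (labelsF ds)
    Ncs = length (labelsF cs)
    regroup : ∀ t a b p q n o → t + (a + p + n * t) + (b + q + o * t) ≡ b + (a + (p + q)) + suc (n + o) * t
    regroup = solve-∀

  sum-rootFactor-≥2 : ∀ (f : ℕ → ℕ) k → sum (map rootFactor (applyUpTo (λ i → suc (suc (f i))) k)) ≡ k
  sum-rootFactor-≥2 f zero    = refl
  sum-rootFactor-≥2 f (suc k) = cong suc (sum-rootFactor-≥2 (f ∘ suc) k)

  slotWeight-onSet : ∀ {k v cs} → OnSet (suc k) (node v cs) → slotWeight v cs ≡ x + k + k * t
  slotWeight-onSet {k} {v} {cs} onSet = begin
    slotWeight v cs
      ≡⟨ slotWeight-labels v cs ⟩
    sum (map rootFactor (labels (node v cs))) + length (labelsF cs) * t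
      ≡⟨ cong₂ (λ r n → r + n * t) (sum-↭ (map⁺ rootFactor onSet)) (onSet-size {v = v} {cs} onSet) ⟩
    sum (map rootFactor (applyUpTo suc (suc k))) + k * t
      ≡⟨ cong (λ r → x + r + k * t) (sum-rootFactor-≥2 (λ i → i) k) ⟩
    x + k + k * t ∎
    where open ≡-Reasoning

  sum-weights-grown : ∀ k → sum (map (weight x t) (grown true k)) ≡ prodUpTo k (λ j → x + j + j * t)
  sum-weights-grown = sum-grown (weight x t) (λ j → x + j + j * t) (weight-leaf 1) sum-weights-growths
    where
    open ≡-Reasoning
    sum-weights-growths : ∀ k {T} → T ∈ grown true k →
                   sum (map (weight x t) (growths true (suc (suc k)) T)) ≡ weight x t T * (x + k + k * t)
    sum-weights-growths k {node v cs} T∈ = begin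
      sum (map (weight x t) (map (node v) (insertions true (suc (suc k)) cs)))
        ≡⟨ sum-map-∘ (weight x t) (node v) (insertions true (suc (suc k)) cs) ⟩
      sum (map (weight x t ∘ node v) (insertions true (suc (suc k)) cs))
        ≡⟨ sum-weights-insertions v cs (All.tail (onSet-< {T = node v cs} onSet)) ⟩
      weight x t (node v cs) * slotWeight v cs
        ≡⟨ cong (weight x t (node v cs) *_) (slotWeight-onSet {v = v} {cs} onSet) ⟩
      weight x t (node v cs) * (x + k + k * t) ∎
      where onSet = grown-onSet k T∈

prodUpTo-factorial : ∀ k → prodUpTo k (λ j → suc (width false * j)) ≡ k !
prodUpTo-factorial = prodUpTo-recurrence _ _! refl (λ k → cong (λ j → suc j * k !) (sym (*-identityˡ k)))

prodUpTo-oddDoubleFact : ∀ k → prodUpTo k (λ j → suc (width true * j)) ≡ oddDoubleFact k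
prodUpTo-oddDoubleFact = prodUpTo-recurrence _ oddDoubleFact refl (λ k → cong (_* oddDoubleFact k) (+-comm (2 * k) 1))

proposition2p5 : ∀ (n : ℕ) → 1 ≤ n →
    ((x t : ℕ) (L : List PTree) → Enumerates (InP0 n) L →
      sum (map (weight x t) L) ≡ prodUpTo (n ∸ 1) (λ k → x + k + k * t))
    × ((L : List PTree) → Enumerates (IncTree n) L → length L ≡ (n ∸ 1) !)
    × ((L : List PTree) → Enumerates (IncPlane n) L → length L ≡ oddDoubleFact (n ∸ 1))
proposition2p5 (suc k) _ = weightedCount , increasingTreeCount , increasingPlaneTreeCount
  where
  weightedCount : ∀ x t L → Enumerates (InP0 (suc k)) L → sum (map (weight x t) L) ≡ prodUpTo k (λ j → x + j + j * t)
  weightedCount x t L enum =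
    trans (sum-↭ (map⁺ (weight x t) (enumerations-↭ ⇔-refl enum (grown-enumerates noImproperClass k))))
          (sum-weights-grown x t k)

  increasingTreeCount : ∀ L → Enumerates (IncTree (suc k)) L → length L ≡ k !
  increasingTreeCount L enum =
    trans (↭-length (enumerations-↭ reassociate enum (grown-enumerates sortedIncreasingClass k)))
          (trans (length-grown false k) (prodUpTo-factorial k))
    where
    reassociate : ∀ {T} → IncTree (suc k) T ⇔ (OnSet (suc k) T × Increasing T × SortedChildren T)
    reassociate = mk⇔ (λ ((onSet , inc) , sorted) → onSet , inc , sorted)
                      (λ (onSet , inc , sorted) → (onSet , inc) , sorted)

  increasingPlaneTreeCount : ∀ L → Enumerates (IncPlane (suc k)) L → length L ≡ oddDoubleFact k
  increasingPlaneTreeCount L enum =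
    trans (↭-length (enumerations-↭ ⇔-refl enum (grown-enumerates increasingClass k)))
          (trans (length-grown true k) (prodUpTo-oddDoubleFact k))
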